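{- Let $a\ge 3$ and $m$ be integers with $\frac{a}{2}+1\leq m\leq 2a+1$, and consider solutions $(x_1,\dots,x_m)$ of $x_1+x_2+\cdots+x_{m-1}=ax_m$ in positive integers. Then: (1) there exists a solution using only values in $\{1,2\}$; (2) there exists a solution using only values in $\{1,3\}$ iff $a\equiv m-1\pmod 2$; (3) there exists a solution using only values in $\{2,3\}$ iff $\frac{2a}{3}+1\leq m\leq\frac{3a}{2}+1$; (4) there exists a solution using only values in $\{1,4\}$ iff $a\equiv m-1\pmod 3$.
   Context: "Using only values in $S$" means every $x_i$ (including $x_m$) lies in $S$; not all elements of $S$ need occur. -}

module Defs where

open import Data.Nat using (ℕ; suc; _+_; _*_; _<_)
open import Data.Fin using (Fin; inject₁; fromℕ)
open import Data.Vec.Functional using (Vector; foldr)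
open import Relation.Binary.PropositionalEquality using (_≡_)
open import Data.Product using (_×_; ∃)
open import Data.Empty using (⊥)

sumFin : (n : ℕ) → (Fin n → ℕ) → ℕ
sumFin n f = foldr _+_ 0 f

-- (x₁,…,x_m) with m = suc n, as x : Fin (suc n) → ℕ;
-- x₁..x_{m-1} are the entries at inject₁ i, x_m is the entry at fromℕ n.
-- A positive-integer solution of x₁ + ⋯ + x_{m-1} = a · x_m.
IsSolution : (a n : ℕ) → (Fin (suc n) → ℕ) → Set
IsSolution a n x =
  ((i : Fin (suc n)) → 0 < x i) ×
  (sumFin n (λ i → x (inject₁ i)) ≡ a * x (fromℕ n))

HasSolutionIn : (a m : ℕ) → (ℕ → Set) → Set
HasSolutionIn a 0 S = ⊥
HasSolutionIn a (suc n) S =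
  ∃ λ (x : Fin (suc n) → ℕ) → IsSolution a n x × ((i : Fin (suc n)) → S (x i))

-- Write the first m − 1 = n entries of a solution with values in {p, p + s} as
-- n values p of which c are raised by s: the equation becomes p n + c s = a t
-- with 0 ≤ c ≤ n and t ∈ {p, p + s}. Hence the left-hand sides that occur are
-- exactly the x with p n ≤ x ≤ (p + s) n and x ≡ p n (mod s), and each part
-- reduces to deciding whether a p or a (p + s) is such an x; comparing a
-- with n tells which of the two to try.
module Submission where

open import Defs
open import Data.Nat using (ℕ; zero; suc; _+_; _*_; _≤_; _<_; _∸_; _%_; _/_; NonZero; >-nonZero⁻¹; z≤n; s≤s; z<s)
open import Data.Nat.Properties
open import Data.Nat.DivMod using (n%1≡0; m≡m%n+[m/n]*n; [m+kn]%n≡m%n; /-monoˡ-≤)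
open import Data.Nat.Tactic.RingSolver using (solve-∀)
open import Data.Fin using (Fin; inject₁; fromℕ; punchIn; zero; suc)
open import Data.Vec.Functional using (Vector; []; _∷_; tail; insertAt)
open import Data.Vec.Functional.Relation.Binary.Pointwise.Properties using (foldr-cong)
open import Data.Vec.Functional.Properties using (insertAt-lookup; insertAt-punchIn)
open import Data.Product using (_×_; _,_; ∃)
open import Data.Sum using (_⊎_; inj₁; inj₂; [_,_]; map)
open import Data.Product.Function.NonDependent.Propositional using (_×-⇔_)
open import Function.Bundles using (_⇔_; mk⇔; Equivalence)
open import Function.Properties.Equivalence using () renaming (trans to ⇔-trans; sym to ⇔-sym)
open import Relation.Binary.PropositionalEquality using (_≡_; refl; sym; trans; cong; cong₂; subst; subst₂; module ≡-Reasoning)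

OneOf : ℕ → ℕ → ℕ → Set
OneOf p q v = v ≡ p ⊎ v ≡ q

Reachable : (p s n x : ℕ) → Set
Reachable p s n x = ∃ λ c → c ≤ n × p * n + c * s ≡ x

m%k≡n%k⇒m≡n+c*k : ∀ k .{{_ : NonZero k}} m n → m % k ≡ n % k → n ≤ m → ∃ λ c → n + c * k ≡ m
m%k≡n%k⇒m≡n+c*k k m n m%k≡n%k n≤m with m≤n⇒∃[o]m+o≡n (/-monoˡ-≤ k n≤m)
... | c , n/k+c≡m/k = c , (begin
  n + c * k                   ≡⟨ cong (_+ c * k) (m≡m%n+[m/n]*n n k) ⟩
  n % k + (n / k) * k + c * k ≡⟨ regroup (n % k) (n / k) c k ⟩
  n % k + (n / k + c) * k     ≡⟨ cong₂ _+_ (sym m%k≡n%k) (cong (_* k) n/k+c≡m/k) ⟩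
  m % k + (m / k) * k         ≡⟨ sym (m≡m%n+[m/n]*n m k) ⟩
  m                           ∎)
  where
  open ≡-Reasoning
  regroup : ∀ r q c k → r + q * k + c * k ≡ r + (q + c) * k
  regroup = solve-∀

[m*[1+k]]%k≡m%k : ∀ m k .{{_ : NonZero k}} → (m * suc k) % k ≡ m % k
[m*[1+k]]%k≡m%k m k = trans (cong (_% k) (*-suc m k)) ([m+kn]%n≡m%n m m k)

reachable⇒bounds : ∀ p s n x → Reachable p s n x → p * n ≤ x × x ≤ (p + s) * n
reachable⇒bounds p s n x (c , c≤n , refl) =
  m≤m+n (p * n) (c * s) ,
  (begin
    p * n + c * s ≤⟨ +-monoʳ-≤ (p * n) (*-monoˡ-≤ s c≤n) ⟩
    p * n + n * s ≡⟨ cong (p * n +_) (*-comm n s) ⟩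
    p * n + s * n ≡⟨ sym (*-distribʳ-+ n p s) ⟩
    (p + s) * n   ∎)
  where open ≤-Reasoning

reachable⇒% : ∀ p s .{{_ : NonZero s}} n x → Reachable p s n x → x % s ≡ (p * n) % s
reachable⇒% p s n x (c , _ , refl) = [m+kn]%n≡m%n (p * n) c s

reachable : ∀ p s .{{_ : NonZero s}} n x →
  p * n ≤ x → x ≤ (p + s) * n → x % s ≡ (p * n) % s → Reachable p s n x
reachable p s n x lower upper x≡pn with m%k≡n%k⇒m≡n+c*k s x (p * n) x≡pn lower
... | c , refl = c , *-cancelʳ-≤ c n s (+-cancelˡ-≤ (p * n) _ _ (begin
  p * n + c * s ≤⟨ upper ⟩
  (p + s) * n   ≡⟨ *-distribʳ-+ n p s ⟩
  p * n + s * n ≡⟨ cong (p * n +_) (*-comm s n) ⟩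
  p * n + n * s ∎)) , refl
  where open ≤-Reasoning

reachable₁⇔ : ∀ p n x → Reachable p 1 n x ⇔ (p * n ≤ x × x ≤ (p + 1) * n)
reachable₁⇔ p n x = mk⇔ (reachable⇒bounds p 1 n x)
  (λ (lower , upper) → reachable p 1 n x lower upper (trans (n%1≡0 x) (sym (n%1≡0 (p * n)))))

sum-oneOf : ∀ p s n (y : Vector ℕ n) → (∀ i → OneOf p (p + s) (y i)) → Reachable p s n (sumFin n y)
sum-oneOf p s zero y _ = 0 , z≤n , trans (+-identityʳ (p * 0)) (*-zeroʳ p)
sum-oneOf p s (suc n) y y∈ with sum-oneOf p s n (tail y) (λ i → y∈ (suc i)) | y∈ zero
... | c , c≤n , eq | inj₁ y₀≡p = c , m≤n⇒m≤1+n c≤n , trans (regroup p n c s) (cong₂ _+_ (sym y₀≡p) eq)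
  where
  regroup : ∀ p n c s → p * suc n + c * s ≡ p + (p * n + c * s)
  regroup = solve-∀
... | c , c≤n , eq | inj₂ y₀≡p+s = suc c , s≤s c≤n , trans (regroup p n c s) (cong₂ _+_ (sym y₀≡p+s) eq)
  where
  regroup : ∀ p n c s → p * suc n + suc c * s ≡ p + s + (p * n + c * s)
  regroup = solve-∀

oneOf-sum : ∀ p s n x → Reachable p s n x →
  ∃ λ (y : Vector ℕ n) → (∀ i → OneOf p (p + s) (y i)) × sumFin n y ≡ x
oneOf-sum p s zero x (zero , _ , refl) = [] , (λ ()) , sym (trans (+-identityʳ (p * 0)) (*-zeroʳ p))
oneOf-sum p s (suc n) x (zero , _ , refl) with oneOf-sum p s n (p * n + 0) (0 , z≤n , refl)
... | y , y∈ , eq = p ∷ y , (λ { zero → inj₁ refl ; (suc i) → y∈ i }) ,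
  trans (cong (p +_) eq) (regroup p n)
  where
  regroup : ∀ p n → p + (p * n + 0) ≡ p * suc n + 0
  regroup = solve-∀
oneOf-sum p s (suc n) x (suc c , s≤s c≤n , refl) with oneOf-sum p s n (p * n + c * s) (c , c≤n , refl)
... | y , y∈ , eq = p + s ∷ y , (λ { zero → inj₂ refl ; (suc i) → y∈ i }) ,
  trans (cong (p + s +_) eq) (regroup p s n c)
  where
  regroup : ∀ p s n c → p + s + (p * n + c * s) ≡ p * suc n + suc c * s
  regroup = solve-∀

punchIn-fromℕ : ∀ n (j : Fin n) → punchIn (fromℕ n) j ≡ inject₁ j
punchIn-fromℕ (suc n) zero    = refl
punchIn-fromℕ (suc n) (suc j) = cong suc (punchIn-fromℕ n j)

insertAt-inject₁ : ∀ {n} (xs : Vector ℕ n) v (j : Fin n) → insertAt xs (fromℕ n) v (inject₁ j) ≡ xs j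
insertAt-inject₁ {n} xs v j = subst (λ k → insertAt xs (fromℕ n) v k ≡ xs j)
  (punchIn-fromℕ n j) (insertAt-punchIn xs (fromℕ n) v j)

insertAt-all : ∀ (P : ℕ → Set) {n} {xs : Vector ℕ n} {v} → (∀ j → P (xs j)) → P v →
  ∀ i k → P (insertAt xs i v k)
insertAt-all P         Pxs Pv zero    zero    = Pv
insertAt-all P         Pxs Pv zero    (suc k) = Pxs k
insertAt-all P {suc n} Pxs Pv (suc i) zero    = Pxs zero
insertAt-all P {suc n} Pxs Pv (suc i) (suc k) = insertAt-all P (λ j → Pxs (suc j)) Pv i k

sumFin-cong : ∀ n {f g : Vector ℕ n} → (∀ i → f i ≡ g i) → sumFin n f ≡ sumFin n g
sumFin-cong n = foldr-cong {R = _≡_} {S = _≡_} {f = _+_} {g = _+_} (cong₂ _+_) refl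

solution⇔reachable : ∀ p s a n → 0 < p →
  HasSolutionIn a (suc n) (OneOf p (p + s)) ⇔ (Reachable p s n (a * p) ⊎ Reachable p s n (a * (p + s)))
solution⇔reachable p s a n 0<p = mk⇔ reachable-from-solution
  [ solution-from-reachable p (inj₁ refl) , solution-from-reachable (p + s) (inj₂ refl) ]
  where
  reachable-from-solution : HasSolutionIn a (suc n) (OneOf p (p + s)) →
    Reachable p s n (a * p) ⊎ Reachable p s n (a * (p + s))
  reachable-from-solution (x , (_ , sum≡a*last) , x∈) = map reachable-at reachable-at (x∈ (fromℕ n))
    where
    reachable-at : ∀ {t} → x (fromℕ n) ≡ t → Reachable p s n (a * t)
    reachable-at refl = subst (Reachable p s n) sum≡a*last
      (sum-oneOf p s n (λ i → x (inject₁ i)) (λ i → x∈ (inject₁ i)))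

  oneOf-positive : ∀ {v} → OneOf p (p + s) v → 0 < v
  oneOf-positive (inj₁ refl) = 0<p
  oneOf-positive (inj₂ refl) = ≤-trans 0<p (m≤m+n p s)

  solution-from-reachable : ∀ t → OneOf p (p + s) t → Reachable p s n (a * t) →
    HasSolutionIn a (suc n) (OneOf p (p + s))
  solution-from-reachable t t∈ r with oneOf-sum p s n (a * t) r
  ... | y , y∈ , sum≡a*t = x , (positive , sum-x) , insertAt-all (OneOf p (p + s)) y∈ t∈ (fromℕ n)
    where
    x = insertAt y (fromℕ n) t
    positive = insertAt-all (0 <_) (λ j → oneOf-positive (y∈ j)) (oneOf-positive t∈) (fromℕ n)
    sum-x : sumFin n (λ i → x (inject₁ i)) ≡ a * x (fromℕ n)
    sum-x = trans (sumFin-cong n (insertAt-inject₁ y t))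
                  (trans sum≡a*t (cong (a *_) (sym (insertAt-lookup y (fromℕ n) t))))

oneOf-1-suc-k⇔ : ∀ k .{{_ : NonZero k}} a n → a ≤ 2 * n → n ≤ 2 * a →
  HasSolutionIn a (suc n) (OneOf 1 (1 + k)) ⇔ a % k ≡ n % k
oneOf-1-suc-k⇔ k a n a≤2n n≤2a = ⇔-trans (solution⇔reachable 1 k a n z<s) (mk⇔
  [ (λ r → mod-from (a * 1) (cong (_% k) (*-identityʳ a)) (reachable⇒% 1 k n (a * 1) r))
  , (λ r → mod-from (a * suc k) ([m*[1+k]]%k≡m%k a k) (reachable⇒% 1 k n (a * suc k) r)) ]
  reachable-from-mod)
  where
  open ≤-Reasoning

  mod-from : ∀ x → x % k ≡ a % k → x % k ≡ (1 * n) % k → a % k ≡ n % k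
  mod-from x x≡a x≡n = trans (sym x≡a) (trans x≡n (cong (_% k) (*-identityˡ n)))

  mod-to : ∀ x → x % k ≡ a % k → a % k ≡ n % k → x % k ≡ (1 * n) % k
  mod-to x x≡a a≡n = trans x≡a (trans a≡n (cong (_% k) (sym (*-identityˡ n))))

  2*n≤[1+k]*n : 2 * n ≤ (1 + k) * n
  2*n≤[1+k]*n = *-monoˡ-≤ n (s≤s (>-nonZero⁻¹ k))

  reachable-from-mod : a % k ≡ n % k →
    Reachable 1 k n (a * 1) ⊎ Reachable 1 k n (a * (1 + k))
  reachable-from-mod a≡n with ≤-total n a
  ... | inj₁ n≤a = inj₁ (reachable 1 k n (a * 1)
    (subst₂ _≤_ (sym (*-identityˡ n)) (sym (*-identityʳ a)) n≤a)
    (begin a * 1 ≡⟨ *-identityʳ a ⟩ a ≤⟨ a≤2n ⟩ 2 * n ≤⟨ 2*n≤[1+k]*n ⟩ (1 + k) * n ∎)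
    (mod-to (a * 1) (cong (_% k) (*-identityʳ a)) a≡n))
  ... | inj₂ a≤n = inj₂ (reachable 1 k n (a * suc k)
    (begin 1 * n ≡⟨ *-identityˡ n ⟩ n ≤⟨ n≤2a ⟩ 2 * a ≤⟨ *-monoˡ-≤ a (s≤s (>-nonZero⁻¹ k)) ⟩
           suc k * a ≡⟨ *-comm (suc k) a ⟩ a * suc k ∎)
    (begin a * suc k ≡⟨ *-comm a (suc k) ⟩ suc k * a ≤⟨ *-monoʳ-≤ (suc k) a≤n ⟩ (1 + k) * n ∎)
    (mod-to (a * suc k) ([m*[1+k]]%k≡m%k a k) a≡n))

oneOf-2-3⇔ : ∀ a n → HasSolutionIn a (suc n) (OneOf 2 3) ⇔ (2 * a ≤ 3 * n × 2 * n ≤ 3 * a)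
oneOf-2-3⇔ a n = ⇔-trans (solution⇔reachable 2 1 a n z<s) (mk⇔
  [ (λ r → bounds-from-2 (reachable⇒bounds 2 1 n (a * 2) r))
  , (λ r → bounds-from-3 (reachable⇒bounds 2 1 n (a * 3) r)) ]
  reachable-from-bounds)
  where
  open ≤-Reasoning

  2*a≤3*a : 2 * a ≤ 3 * a
  2*a≤3*a = *-monoˡ-≤ a (n≤1+n 2)

  bounds-from-2 : 2 * n ≤ a * 2 × a * 2 ≤ 3 * n → 2 * a ≤ 3 * n × 2 * n ≤ 3 * a
  bounds-from-2 (lower , upper) =
    subst (_≤ 3 * n) (*-comm a 2) upper ,
    (begin 2 * n ≤⟨ lower ⟩ a * 2 ≡⟨ *-comm a 2 ⟩ 2 * a ≤⟨ 2*a≤3*a ⟩ 3 * a ∎)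

  bounds-from-3 : 2 * n ≤ a * 3 × a * 3 ≤ 3 * n → 2 * a ≤ 3 * n × 2 * n ≤ 3 * a
  bounds-from-3 (lower , upper) =
    (begin 2 * a ≤⟨ *-monoʳ-≤ 2 a≤n ⟩ 2 * n ≤⟨ *-monoˡ-≤ n (n≤1+n 2) ⟩ 3 * n ∎) ,
    subst (2 * n ≤_) (*-comm a 3) lower
    where
    a≤n : a ≤ n
    a≤n = *-cancelʳ-≤ a n 3 (subst (a * 3 ≤_) (*-comm 3 n) upper)

  reachable-from-bounds : 2 * a ≤ 3 * n × 2 * n ≤ 3 * a →
    Reachable 2 1 n (a * 2) ⊎ Reachable 2 1 n (a * 3)
  reachable-from-bounds (2a≤3n , 2n≤3a) with ≤-total n a
  ... | inj₁ n≤a = inj₁ (Equivalence.from (reachable₁⇔ 2 n (a * 2))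
    ( (begin 2 * n ≤⟨ *-monoʳ-≤ 2 n≤a ⟩ 2 * a ≡⟨ *-comm 2 a ⟩ a * 2 ∎)
    , subst (_≤ 3 * n) (*-comm 2 a) 2a≤3n))
  ... | inj₂ a≤n = inj₂ (Equivalence.from (reachable₁⇔ 2 n (a * 3))
    ( subst (2 * n ≤_) (*-comm 3 a) 2n≤3a
    , (begin a * 3 ≤⟨ *-monoˡ-≤ 3 a≤n ⟩ n * 3 ≡⟨ *-comm n 3 ⟩ 3 * n ∎)))

k*[1+n]≡k*n+k : ∀ k n → k * suc n ≡ k * n + k
k*[1+n]≡k*n+k k n = trans (*-suc k n) (+-comm k (k * n))

m+k≤k*[1+n]⇔m≤k*n : ∀ k m n → m + k ≤ k * suc n ⇔ m ≤ k * n
m+k≤k*[1+n]⇔m≤k*n k m n = mk⇔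
  (λ le → +-cancelʳ-≤ k m (k * n) (subst (m + k ≤_) (k*[1+n]≡k*n+k k n) le))
  (λ le → subst (m + k ≤_) (sym (k*[1+n]≡k*n+k k n)) (+-monoˡ-≤ k le))

k*[1+n]≤m+k⇔k*n≤m : ∀ k n m → k * suc n ≤ m + k ⇔ k * n ≤ m
k*[1+n]≤m+k⇔k*n≤m k n m = mk⇔
  (λ le → +-cancelʳ-≤ k (k * n) m (subst (_≤ m + k) (k*[1+n]≡k*n+k k n) le))
  (λ le → subst (_≤ m + k) (sym (k*[1+n]≡k*n+k k n)) (+-monoˡ-≤ k le))

lemma7 : (a m : ℕ) → 3 ≤ a → a + 2 ≤ 2 * m → m ≤ 2 * a + 1 →
    HasSolutionIn a m (λ v → v ≡ 1 ⊎ v ≡ 2)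
    × (HasSolutionIn a m (λ v → v ≡ 1 ⊎ v ≡ 3) ⇔ (a % 2 ≡ (m ∸ 1) % 2))
    × (HasSolutionIn a m (λ v → v ≡ 2 ⊎ v ≡ 3) ⇔ ((2 * a + 3 ≤ 3 * m) × (2 * m ≤ 3 * a + 2)))
    × (HasSolutionIn a m (λ v → v ≡ 1 ⊎ v ≡ 4) ⇔ (a % 3 ≡ (m ∸ 1) % 3))
lemma7 a zero _ a+2≤0 _ with ≤-trans (m≤n+m 2 a) a+2≤0
... | ()
lemma7 a (suc n) _ a+2≤2m m≤2a+1 =
  Equivalence.from (oneOf-1-suc-k⇔ 1 a n a≤2n n≤2a) (trans (n%1≡0 a) (sym (n%1≡0 n))) ,
  oneOf-1-suc-k⇔ 2 a n a≤2n n≤2a ,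
  ⇔-trans (oneOf-2-3⇔ a n) (⇔-sym (m+k≤k*[1+n]⇔m≤k*n 3 (2 * a) n ×-⇔ k*[1+n]≤m+k⇔k*n≤m 2 n (3 * a))) ,
  oneOf-1-suc-k⇔ 3 a n a≤2n n≤2a
  where
  a≤2n : a ≤ 2 * n
  a≤2n = Equivalence.to (m+k≤k*[1+n]⇔m≤k*n 2 a n) a+2≤2m
  n≤2a : n ≤ 2 * a
  n≤2a = +-cancelʳ-≤ 1 n (2 * a) (subst (_≤ 2 * a + 1) (+-comm 1 n) m≤2a+1)
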